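{- For every positive integer $N$, writing $[N]=\{1,2,\ldots,N\}\subset\mathbb{Z}$, \[ d_s([N])=d_d^-([N])=\lfloor\log_3 N\rfloor+\big\lceil \log_3 2N-\lfloor\log_3 N\rfloor\big\rceil. \]
   Context: $[N]$ is viewed as an additive set in $\mathbb{Z}$. A set $D$ is dissociated if its subset sums are pairwise distinct (equivalently, the only combination $\sum_{x\in D}\varepsilon_x x$ with $\varepsilon_x\in\{ -1,0,1\}$ equal to $0$ is the trivial one); $D\subset A$ is maximal dissociated in $A$ if no dissociated $D'\subset A$ strictly contains $D$; $d_d^-(A)=\min\{|D|:D\subset A\text{ maximal dissociated}\}$. The 1-span $\langle S\rangle$ is the set of all sums $\sum_{s\in S}\varepsilon_s s$ with $\varepsilon_s\in\{ -1,0,1\}$, and $d_s(A)=\min\{|S|:S\subset A,\ \langle S\rangle\supset A\}$. -}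

module Defs where

open import Data.Nat using (ℕ; zero; suc; _+_; _^_; _≤_; _<_; _*_)
open import Data.Integer as ℤ using (ℤ; +_)
open import Data.Fin using (Fin; zero; suc)
open import Data.List using (List; []; _∷_; length)
open import Data.List.Relation.Unary.All using (All)
open import Data.List.Relation.Unary.Unique.Propositional using (Unique)
open import Data.List.Membership.Propositional using (_∈_)
open import Data.Product using (Σ; _×_; ∃)
open import Relation.Binary.PropositionalEquality using (_≡_)

InInterval : ℕ → ℕ → Set
InInterval N x = 1 ≤ x × x ≤ N

-- A finite set of integers represented by a duplicate-free list; S ⊆ [N]
SubsetOfInterval : ℕ → List ℕ → Set
SubsetOfInterval N S = Unique S × All (InInterval N) S

_⊆_ : List ℕ → List ℕ → Set
S ⊆ T = ∀ {x} → x ∈ S → x ∈ T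

data Coef : Set where
  neg zer pos : Coef

coefVal : Coef → ℤ
coefVal neg = ℤ.-[1+ 0 ]
coefVal zer = + 0
coefVal pos = + 1

lin : (S : List ℕ) → (Fin (length S) → Coef) → ℤ
lin [] ε = + 0
lin (s ∷ S) ε = coefVal (ε zero) ℤ.* (+ s) ℤ.+ lin S (λ i → ε (suc i))

InSpan : List ℕ → ℤ → Set
InSpan S x = Σ (Fin (length S) → Coef) λ ε → lin S ε ≡ x

SpansInterval : ℕ → List ℕ → Set
SpansInterval N S = ∀ x → InInterval N x → InSpan S (+ x)

Dissociated : List ℕ → Set
Dissociated D = ∀ (ε : Fin (length D) → Coef) → lin D ε ≡ + 0 → ∀ i → ε i ≡ zer

MaxDissociatedIn : ℕ → List ℕ → Set
MaxDissociatedIn N D =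
  SubsetOfInterval N D × Dissociated D ×
  (∀ D' → SubsetOfInterval N D' → Dissociated D' → D ⊆ D' → D' ⊆ D)

IsMinimum : (ℕ → Set) → ℕ → Set
IsMinimum P n = P n × (∀ m → P m → n ≤ m)

IsDs : ℕ → ℕ → Set
IsDs N = IsMinimum (λ m → ∃ λ S → SubsetOfInterval N S × SpansInterval N S × length S ≡ m)

IsDdMinus : ℕ → ℕ → Set
IsDdMinus N = IsMinimum (λ m → ∃ λ D → MaxDissociatedIn N D × length D ≡ m)

IsFloorLog3 : ℕ → ℕ → Set
IsFloorLog3 N k = 3 ^ k ≤ N × N < 3 ^ suc k

-- m = ⌈log₃ (2N) − k⌉  (least m with log₃(2N) − k ≤ m, i.e. 2N ≤ 3^(k+m))
IsCeilLog3Sub : ℕ → ℕ → ℕ → Set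
IsCeilLog3Sub N k m = 2 * N ≤ 3 ^ (k + m) × (∀ m' → m' < m → 3 ^ (k + m') < 2 * N)

module Submission where

-- Since ⟨S⟩ = -⟨S⟩, a set S whose 1-span contains [N] spans all 2N + 1 integers of [-N, N], and
-- ⟨S⟩ has at most 3^|S| elements; a maximal dissociated D ⊆ [N] spans [N], for an x ∈ [N] outside
-- ⟨D⟩ could be added to D. So both minima are at least the least n with 2N ≤ 3^n (3^n is odd),
-- which is the right-hand side. Conversely, if 3^(n-1) < 2N ≤ 3^n, the powers 1, 3, …, 3^(n-2) are
-- dissociated with span exactly [-M, M], M = (3^(n-1) - 1)/2, and adjoining x = min(N, 3^(n-1)) > M
-- gives a dissociated set of size n spanning [-(x + M), x + M] ⊇ [N]. It is maximal dissociated,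
-- because a dissociated superset T of S cannot contain an element of ⟨S⟩ outside S.

open import Defs
open import Data.Nat using (ℕ; _+_; _≤_)
open import Data.Product using (_×_)

open import Data.Nat using (zero; suc; _*_; _∸_; _^_; _<_; _⊓_; z≤n; s≤s; s≤s⁻¹; _≤?_)
import Data.Nat.Properties as ℕ
open import Data.Integer as ℤ using (ℤ; +_; -[1+_]; 0ℤ; -_; ∣_∣)
import Data.Integer.Properties as ℤ
open import Data.Integer.Tactic.RingSolver using (solve-∀)
import Data.Nat.Tactic.RingSolver as ℕ-Solver
open import Data.Fin using (Fin; toℕ; splitAt; join; funToFin; finToFun)
  renaming (zero to 0F; suc to sucF)
import Data.Fin.Properties as Fin
open import Data.Vec.Functional using (tail; updateAt) renaming (_∷_ to _∷ᵥ_)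
open import Data.Vec.Functional.Properties using (updateAt-updates; updateAt-minimal)
open import Data.List using (List; []; _∷_; length; lookup)
open import Data.List.Relation.Unary.All as All using (_∷_)
open import Data.List.Relation.Unary.All.Properties using (¬Any⇒All¬; All¬⇒¬Any)
open import Data.List.Relation.Unary.Any using (here; there; index)
open import Data.List.Relation.Unary.Any.Properties using (lookup-index)
open import Data.List.Relation.Unary.Unique.Propositional using (Unique)
open import Data.List.Relation.Unary.AllPairs using ([]; _∷_)
open import Data.List.Membership.Propositional using (_∈_; _∉_)
open import Data.List.Membership.DecPropositional ℕ._≟_ using (_∈?_)
open import Data.Product using (∃; ∃₂; _,_; proj₁; proj₂)
open import Data.Sum using (_⊎_; inj₁; inj₂; [_,_]′)
open import Function using (_∘_; const)
open import Function.Definitions using (Injective)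
open import Relation.Nullary using (¬_; Dec; yes; no; contradiction)
open import Relation.Nullary.Decidable using (map′)
open import Relation.Binary.PropositionalEquality

private variable
  z : ℤ
  N M n x : ℕ
  S T : List ℕ

private
  i+[j-i]≡j : ∀ i j → i ℤ.+ (j ℤ.- i) ≡ j
  i+[j-i]≡j = solve-∀

  i+j≡k⇒j≡k-i : ∀ i j k → i ℤ.+ j ≡ k → j ≡ k ℤ.- i
  i+j≡k⇒j≡k-i i j k eq = trans (sym (j≡[i+j]-i i j)) (cong (ℤ._- i) eq)
    where
    j≡[i+j]-i : ∀ i j → (i ℤ.+ j) ℤ.- i ≡ j
    j≡[i+j]-i = solve-∀

  2*n≡n+n : ∀ n → 2 * n ≡ n + n
  2*n≡n+n n = cong (_+_ n) (ℕ.+-identityʳ n)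

m≤n+o⇒m∸n≤o : ∀ {m n o} → m ≤ n + o → m ∸ n ≤ o
m≤n+o⇒m∸n≤o {m} {n} {o} m≤n+o =
  ℕ.≤-trans (ℕ.∸-monoˡ-≤ n m≤n+o) (ℕ.≤-reflexive (ℕ.m+n∸m≡n n o))

∣m⊖n∣≤ : ∀ {m n k} → m ≤ n + k → n ≤ m + k → ∣ m ℤ.⊖ n ∣ ≤ k
∣m⊖n∣≤ {m} {n} {k} m≤n+k n≤m+k with ℕ.≤-total n m
... | inj₁ n≤m = subst (_≤ k) (sym (cong ∣_∣ (ℤ.⊖-≥ n≤m))) (m≤n+o⇒m∸n≤o m≤n+k)
... | inj₂ m≤n = subst (_≤ k) (sym ∣m⊖n∣≡n∸m) (m≤n+o⇒m∸n≤o n≤m+k)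
  where
  ∣m⊖n∣≡n∸m : ∣ m ℤ.⊖ n ∣ ≡ n ∸ m
  ∣m⊖n∣≡n∸m = trans (cong ∣_∣ (ℤ.⊖-≤ m≤n)) (ℤ.∣-i∣≡∣i∣ (+ (n ∸ m)))

infixl 7 _·_
_·_ : Coef → ℕ → ℤ
c · s = coefVal c ℤ.* + s

pos·x≡x : ∀ x → pos · x ≡ + x
pos·x≡x x = ℤ.*-identityˡ (+ x)

neg·x≡-x : ∀ x → neg · x ≡ - + x
neg·x≡-x x = ℤ.-1*i≡-i (+ x)

∣c·x∣≤x : ∀ c x → ∣ c · x ∣ ≤ x
∣c·x∣≤x neg x =
  ℕ.≤-reflexive (trans (ℤ.∣i*j∣≡∣i∣*∣j∣ (coefVal neg) (+ x)) (ℕ.*-identityˡ x))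
∣c·x∣≤x zer x = z≤n
∣c·x∣≤x pos x = ℕ.≤-reflexive (cong ∣_∣ (pos·x≡x x))

negate : Coef → Coef
negate neg = pos
negate zer = zer
negate pos = neg

negate-· : ∀ c x → negate c · x ≡ - (c · x)
negate-· neg x =
  trans (pos·x≡x x) (sym (trans (cong -_ (neg·x≡-x x)) (ℤ.neg-involutive (+ x))))
negate-· zer x = refl
negate-· pos x = trans (neg·x≡-x x) (cong -_ (sym (pos·x≡x x)))

lin-negate : ∀ S (ε : Fin (length S) → Coef) → lin S (negate ∘ ε) ≡ - lin S ε
lin-negate [] ε = refl
lin-negate (s ∷ S) ε = begin
  negate (ε 0F) · s ℤ.+ lin S (negate ∘ tail ε)
    ≡⟨ cong₂ ℤ._+_ (negate-· (ε 0F) s) (lin-negate S (tail ε)) ⟩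
  - (ε 0F · s) ℤ.+ - lin S (tail ε)
    ≡⟨ ℤ.neg-distrib-+ (ε 0F · s) (lin S (tail ε)) ⟨
  - lin (s ∷ S) ε ∎
  where open ≡-Reasoning

lin-zeros : ∀ S → lin S (const zer) ≡ 0ℤ
lin-zeros [] = refl
lin-zeros (s ∷ S) = trans (ℤ.+-identityˡ _) (lin-zeros S)

lin-cong : ∀ S {ε δ : Fin (length S) → Coef} → (∀ i → ε i ≡ δ i) → lin S ε ≡ lin S δ
lin-cong [] ε≗δ = refl
lin-cong (s ∷ S) ε≗δ =
  cong₂ (λ c r → c · s ℤ.+ r) (ε≗δ 0F) (lin-cong S (ε≗δ ∘ sucF))

lin-updateAt : ∀ S (δ : Fin (length S) → Coef) p c → δ p ≡ zer →
               lin S (updateAt δ p (const c)) ≡ lin S δ ℤ.+ c · lookup S p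
lin-updateAt (s ∷ S) δ 0F c δp≡zer rewrite δp≡zer =
  trans (ℤ.+-comm (c · s) (lin S (tail δ)))
        (cong (λ r → r ℤ.+ c · s) (sym (ℤ.+-identityˡ (lin S (tail δ)))))
lin-updateAt (s ∷ S) δ (sucF p) c δp≡zer = begin
  δ 0F · s ℤ.+ lin S (updateAt (tail δ) p (const c))
    ≡⟨ cong (ℤ._+_ (δ 0F · s)) (lin-updateAt S (tail δ) p c δp≡zer) ⟩
  δ 0F · s ℤ.+ (lin S (tail δ) ℤ.+ c · lookup S p)
    ≡⟨ ℤ.+-assoc (δ 0F · s) _ _ ⟨
  lin (s ∷ S) δ ℤ.+ c · lookup S p ∎
  where open ≡-Reasoning

span-0 : ∀ S → InSpan S 0ℤ
span-0 S = const zer , lin-zeros S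

span-neg : ∀ S → InSpan S z → InSpan S (- z)
span-neg S (ε , ε↦z) = negate ∘ ε , trans (lin-negate S ε) (cong -_ ε↦z)

span-∷⁺ : ∀ S c → InSpan S (z ℤ.- c · x) → InSpan (x ∷ S) z
span-∷⁺ {z} {x} S c (ε , ε↦) =
  c ∷ᵥ ε , trans (cong (ℤ._+_ (c · x)) ε↦) (i+[j-i]≡j (c · x) z)

span-∷⁻ : ∀ S → InSpan (x ∷ S) z → ∃ λ c → InSpan S (z ℤ.- c · x)
span-∷⁻ {x} {z} S (ε , ε↦z) =
  ε 0F , tail ε , i+j≡k⇒j≡k-i (ε 0F · x) (lin S (tail ε)) z ε↦z

∈⇒span : x ∈ S → InSpan S (+ x)
∈⇒span {x} {x ∷ S} (here refl) =
  span-∷⁺ S pos (subst (InSpan S) (sym x-pos·x≡0) (span-0 S))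
  where
  x-pos·x≡0 : + x ℤ.- pos · x ≡ 0ℤ
  x-pos·x≡0 = trans (cong (λ t → + x ℤ.- t) (pos·x≡x x)) (ℤ.+-inverseʳ (+ x))
∈⇒span {x} {s ∷ S} (there x∈S) =
  span-∷⁺ S zer (subst (InSpan S) (sym (ℤ.+-identityʳ (+ x))) (∈⇒span x∈S))

any-coef? : {P : Coef → Set} → (∀ c → Dec (P c)) → Dec (∃ P)
any-coef? P? with P? neg | P? zer | P? pos
... | yes p | _     | _     = yes (neg , p)
... | _     | yes p | _     = yes (zer , p)
... | _     | _     | yes p = yes (pos , p)
... | no ¬n | no ¬z | no ¬p = no λ { (neg , p) → ¬n p ; (zer , p) → ¬z p ; (pos , p) → ¬p p }

span? : ∀ S z → Dec (InSpan S z)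
span? [] z = map′ (λ z≡0 → (λ ()) , sym z≡0) (sym ∘ proj₂) (z ℤ.≟ 0ℤ)
span? (x ∷ S) z =
  map′ (λ (c , sp) → span-∷⁺ S c sp) (span-∷⁻ S) (any-coef? λ c → span? S (z ℤ.- c · x))

coefIndex : Coef → Fin 3
coefIndex neg = 0F
coefIndex zer = sucF 0F
coefIndex pos = sucF (sucF 0F)

coefIndex-injective : Injective _≡_ _≡_ coefIndex
coefIndex-injective {neg} {neg} _ = refl
coefIndex-injective {zer} {zer} _ = refl
coefIndex-injective {pos} {pos} _ = refl
coefIndex-injective {neg} {zer} ()
coefIndex-injective {neg} {pos} ()
coefIndex-injective {zer} {neg} ()
coefIndex-injective {zer} {pos} ()
coefIndex-injective {pos} {neg} ()
coefIndex-injective {pos} {zer} ()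

span-size : ∀ S (f : Fin n → ℤ) → Injective _≡_ _≡_ f → (∀ i → InSpan S (f i)) →
            n ≤ 3 ^ length S
span-size {n} S f f-injective f∈⟨S⟩ = Fin.injective⇒≤ code-injective
  where
  coeffs : Fin n → Fin (length S) → Coef
  coeffs i = proj₁ (f∈⟨S⟩ i)

  code : Fin n → Fin (3 ^ length S)
  code i = funToFin (coefIndex ∘ coeffs i)

  code-injective : Injective _≡_ _≡_ code
  code-injective {i} {j} codei≡codej = f-injective (begin
    f i               ≡⟨ proj₂ (f∈⟨S⟩ i) ⟨
    lin S (coeffs i)  ≡⟨ lin-cong S same-coeffs ⟩
    lin S (coeffs j)  ≡⟨ proj₂ (f∈⟨S⟩ j) ⟩
    f j               ∎)
    where
    open ≡-Reasoning
    same-coeffs : ∀ k → coeffs i k ≡ coeffs j k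
    same-coeffs k = coefIndex-injective (begin
      coefIndex (coeffs i k)  ≡⟨ Fin.finToFun-funToFin (coefIndex ∘ coeffs i) k ⟨
      finToFun (code i) k     ≡⟨ cong (λ c → finToFun c k) codei≡codej ⟩
      finToFun (code j) k     ≡⟨ Fin.finToFun-funToFin (coefIndex ∘ coeffs j) k ⟩
      coefIndex (coeffs j k)  ∎)

symmetricInterval : ∀ N → Fin (suc N + N) → ℤ
symmetricInterval N = [ +_ ∘ toℕ , -[1+_] ∘ toℕ ]′ ∘ splitAt (suc N)

symmetricInterval-injective : ∀ N → Injective _≡_ _≡_ (symmetricInterval N)
symmetricInterval-injective N {i} {j} eq = begin
  i                                ≡⟨ Fin.join-splitAt (suc N) N i ⟨
  join (suc N) N (splitAt (suc N) i)
    ≡⟨ cong (join (suc N) N) (sides-injective (splitAt (suc N) i) (splitAt (suc N) j) eq) ⟩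
  join (suc N) N (splitAt (suc N) j) ≡⟨ Fin.join-splitAt (suc N) N j ⟩
  j                                ∎
  where
  open ≡-Reasoning
  sides : Fin (suc N) ⊎ Fin N → ℤ
  sides = [ +_ ∘ toℕ , -[1+_] ∘ toℕ ]′
  sides-injective : ∀ u v → sides u ≡ sides v → u ≡ v
  sides-injective (inj₁ a) (inj₁ b) eq = cong inj₁ (Fin.toℕ-injective (ℤ.+-injective eq))
  sides-injective (inj₂ a) (inj₂ b) eq = cong inj₂ (Fin.toℕ-injective (ℤ.-[1+-injective eq))
  sides-injective (inj₁ a) (inj₂ b) ()
  sides-injective (inj₂ a) (inj₁ b) ()

∣symmetricInterval∣≤ : ∀ N i → ∣ symmetricInterval N i ∣ ≤ N
∣symmetricInterval∣≤ N i with splitAt (suc N) i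
... | inj₁ a = Fin.toℕ≤pred[n] a
... | inj₂ b = Fin.toℕ<n b

spansInterval⇒span : ∀ S → SpansInterval N S → ∣ z ∣ ≤ N → InSpan S z
spansInterval⇒span {z = + zero}     S _    _    = span-0 S
spansInterval⇒span {z = + suc n}    S span ∣z∣≤N = span (suc n) (s≤s z≤n , ∣z∣≤N)
spansInterval⇒span {z = -[1+ n ]}   S span ∣z∣≤N = span-neg S (span (suc n) (s≤s z≤n , ∣z∣≤N))

spansInterval-size : ∀ S → SpansInterval N S → suc (N + N) ≤ 3 ^ length S
spansInterval-size {N} S span =
  span-size S (symmetricInterval N) (symmetricInterval-injective N)
    (λ i → spansInterval⇒span S span (∣symmetricInterval∣≤ N i))

single : Fin n → Coef → Fin n → Coef
single p c = updateAt (const zer) p (const c)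

lin-single : ∀ S p c → lin S (single p c) ≡ c · lookup S p
lin-single S p c = begin
  lin S (single p c)                  ≡⟨ lin-updateAt S (const zer) p c refl ⟩
  lin S (const zer) ℤ.+ c · lookup S p ≡⟨ cong (λ r → r ℤ.+ c · lookup S p) (lin-zeros S) ⟩
  0ℤ ℤ.+ c · lookup S p               ≡⟨ ℤ.+-identityˡ (c · lookup S p) ⟩
  c · lookup S p                      ∎
  where open ≡-Reasoning

dissociated-∷ : ∀ S → Dissociated S → ¬ InSpan S (+ x) → Dissociated (x ∷ S)
dissociated-∷ {x} S diss x∉⟨S⟩ ε ε↦0 = λ where
    0F       → head≡zer
    (sucF i) → diss (tail ε) tail↦0 i
  where
  c≡zer : ∀ c → InSpan S (0ℤ ℤ.- c · x) → c ≡ zer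
  c≡zer neg sp = contradiction (subst (InSpan S) 0-neg·x≡x sp) x∉⟨S⟩
    where
    0-neg·x≡x : 0ℤ ℤ.- neg · x ≡ + x
    0-neg·x≡x = trans (ℤ.+-identityˡ _) (trans (cong -_ (neg·x≡-x x)) (ℤ.neg-involutive (+ x)))
  c≡zer zer _  = refl
  c≡zer pos sp = contradiction (subst (InSpan S) -[0-pos·x]≡x (span-neg S sp)) x∉⟨S⟩
    where
    -[0-pos·x]≡x : - (0ℤ ℤ.- pos · x) ≡ + x
    -[0-pos·x]≡x = trans (cong -_ (ℤ.+-identityˡ _)) (trans (ℤ.neg-involutive _) (pos·x≡x x))

  head≡zer : ε 0F ≡ zer
  head≡zer = c≡zer (ε 0F) (proj₂ (span-∷⁻ S (ε , ε↦0)))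

  tail↦0 : lin S (tail ε) ≡ 0ℤ
  tail↦0 = begin
    lin S (tail ε)                 ≡⟨ ℤ.+-identityˡ (lin S (tail ε)) ⟨
    zer · x ℤ.+ lin S (tail ε)     ≡⟨ cong (λ c → c · x ℤ.+ lin S (tail ε)) head≡zer ⟨
    lin (x ∷ S) ε                  ≡⟨ ε↦0 ⟩
    0ℤ                             ∎
    where open ≡-Reasoning

dissociated-tail : ∀ S → Dissociated (x ∷ S) → Dissociated S
dissociated-tail S diss ε ε↦0 i =
  diss (zer ∷ᵥ ε) (trans (ℤ.+-identityˡ (lin S ε)) ε↦0) (sucF i)

dissociated⇒head∉ : ∀ S → Dissociated (x ∷ S) → x ∉ S
dissociated⇒head∉ {x} S diss x∈S = contradiction (diss (pos ∷ᵥ single p neg) x-x≡0 0F) λ ()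
  where
  p : Fin (length S)
  p = index x∈S
  x-x≡0 : pos · x ℤ.+ lin S (single p neg) ≡ 0ℤ
  x-x≡0 = begin
    pos · x ℤ.+ lin S (single p neg)  ≡⟨ cong₂ ℤ._+_ (pos·x≡x x) (lin-single S p neg) ⟩
    + x ℤ.+ neg · lookup S p          ≡⟨ cong (λ y → + x ℤ.+ neg · y) (lookup-index x∈S) ⟨
    + x ℤ.+ neg · x                   ≡⟨ cong (ℤ._+_ (+ x)) (neg·x≡-x x) ⟩
    + x ℤ.- + x                       ≡⟨ ℤ.+-inverseʳ (+ x) ⟩
    0ℤ                                ∎
    where open ≡-Reasoning

dissociated⇒unique : ∀ S → Dissociated S → Unique S
dissociated⇒unique []      _    = []
dissociated⇒unique (x ∷ S) diss =
  ¬Any⇒All¬ S (dissociated⇒head∉ S diss) ∷ dissociated⇒unique S (dissociated-tail S diss)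

dissociated⇒0∉ : ∀ S → Dissociated S → 0 ∉ S
dissociated⇒0∉ S diss 0∈S =
  contradiction (trans (sym p↦pos) (diss (single p pos) p·0≡0 p)) λ ()
  where
  p : Fin (length S)
  p = index 0∈S
  p↦pos : single p pos p ≡ pos
  p↦pos = updateAt-updates p (const zer)
  p·0≡0 : lin S (single p pos) ≡ 0ℤ
  p·0≡0 = trans (lin-single S p pos) (cong (pos ·_) (sym (lookup-index 0∈S)))

dissociated⇒subsetOfInterval : ∀ S → Dissociated S → (∀ {y} → y ∈ S → y ≤ N) →
                               SubsetOfInterval N S
dissociated⇒subsetOfInterval S diss ≤N =
  dissociated⇒unique S diss ,
  All.tabulate λ y∈S → ℕ.n≢0⇒n>0 (λ { refl → dissociated⇒0∉ S diss y∈S }) , ≤N y∈S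

maxDissociated⇒spans : ∀ D → MaxDissociatedIn N D → SpansInterval N D
maxDissociated⇒spans D ((D-unique , D⊆[N]) , diss , maximal) x x∈[N] with span? D (+ x)
... | yes x∈⟨D⟩ = x∈⟨D⟩
... | no  x∉⟨D⟩ =
  contradiction (∈⇒span (maximal (x ∷ D) x∷D⊆[N] x∷D-diss there (here refl))) x∉⟨D⟩
  where
  x∷D⊆[N] : SubsetOfInterval _ (x ∷ D)
  x∷D⊆[N] = (¬Any⇒All¬ D (x∉⟨D⟩ ∘ ∈⇒span) ∷ D-unique) , (x∈[N] ∷ D⊆[N])
  x∷D-diss : Dissociated (x ∷ D)
  x∷D-diss = dissociated-∷ D diss x∉⟨D⟩

extend : ∀ S → Unique S → S ⊆ T → (ε : Fin (length S) → Coef) →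
         ∃ λ δ → lin T δ ≡ lin S ε × (∀ q → lookup T q ∉ S → δ q ≡ zer)
extend {T} []      _                 _   _ = const zer , lin-zeros T , λ _ _ → refl
extend {T} (s ∷ S) (s∉S ∷ S-unique) S⊆T ε with extend S S-unique (S⊆T ∘ there) (tail ε)
... | δ , δ↦ , δ-support = updateAt δ p (const (ε 0F)) , lin≡ , support
  where
  s∈T : s ∈ T
  s∈T = S⊆T (here refl)
  p : Fin (length T)
  p = index s∈T

  δp≡zer : δ p ≡ zer
  δp≡zer = δ-support p λ Tp∈S → All¬⇒¬Any s∉S (subst (_∈ S) (sym (lookup-index s∈T)) Tp∈S)

  lin≡ : lin T (updateAt δ p (const (ε 0F))) ≡ lin (s ∷ S) ε
  lin≡ = begin
    lin T (updateAt δ p (const (ε 0F)))  ≡⟨ lin-updateAt T δ p (ε 0F) δp≡zer ⟩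
    lin T δ ℤ.+ ε 0F · lookup T p
      ≡⟨ cong₂ (λ r y → r ℤ.+ ε 0F · y) δ↦ (sym (lookup-index s∈T)) ⟩
    lin S (tail ε) ℤ.+ ε 0F · s          ≡⟨ ℤ.+-comm (lin S (tail ε)) (ε 0F · s) ⟩
    lin (s ∷ S) ε                        ∎
    where open ≡-Reasoning

  support : ∀ q → lookup T q ∉ s ∷ S → updateAt δ p (const (ε 0F)) q ≡ zer
  support q Tq∉s∷S with p Fin.≟ q
  ... | yes refl = contradiction (here (sym (lookup-index s∈T))) Tq∉s∷S
  ... | no  p≢q  = trans (updateAt-minimal q p δ (p≢q ∘ sym)) (δ-support q (Tq∉s∷S ∘ there))

dissociated⇒∉span : ∀ S → Unique S → S ⊆ T → Dissociated T →
                    ∀ {y} → y ∈ T → y ∉ S → ¬ InSpan S (+ y)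
dissociated⇒∉span {T} S S-unique S⊆T T-diss {y} y∈T y∉S (ε , ε↦y)
  with extend S S-unique S⊆T ε
... | δ , δ↦ , δ-support = contradiction (trans (sym p↦neg) (T-diss δ′ δ′↦0 p)) λ ()
  where
  p : Fin (length T)
  p = index y∈T

  δ′ : Fin (length T) → Coef
  δ′ = updateAt δ p (const neg)

  p↦neg : δ′ p ≡ neg
  p↦neg = updateAt-updates p δ

  δp≡zer : δ p ≡ zer
  δp≡zer = δ-support p λ Tp∈S → y∉S (subst (_∈ S) (sym (lookup-index y∈T)) Tp∈S)

  δ′↦0 : lin T δ′ ≡ 0ℤ
  δ′↦0 = begin
    lin T δ′                       ≡⟨ lin-updateAt T δ p neg δp≡zer ⟩
    lin T δ ℤ.+ neg · lookup T p
      ≡⟨ cong₂ (λ r t → r ℤ.+ neg · t) (trans δ↦ ε↦y) (sym (lookup-index y∈T)) ⟩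
    + y ℤ.+ neg · y                ≡⟨ cong (ℤ._+_ (+ y)) (neg·x≡-x y) ⟩
    + y ℤ.- + y                    ≡⟨ ℤ.+-inverseʳ (+ y) ⟩
    0ℤ                             ∎
    where open ≡-Reasoning

spanning⇒maxDissociated : ∀ S → SubsetOfInterval N S → Dissociated S → SpansInterval N S →
                          MaxDissociatedIn N S
spanning⇒maxDissociated {N} S S⊆[N]@(S-unique , _) diss span = S⊆[N] , diss , maximal
  where
  maximal : ∀ D → SubsetOfInterval N D → Dissociated D → S ⊆ D → D ⊆ S
  maximal D (_ , D⊆[N]) D-diss S⊆D {y} y∈D with y ∈? S
  ... | yes y∈S = y∈S
  ... | no  y∉S = contradiction (span y (All.lookup D⊆[N] y∈D))
                    (dissociated⇒∉span S S-unique S⊆D D-diss y∈D y∉S)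

record BalancedBasis (M : ℕ) (S : List ℕ) : Set where
  field
    dissociated : Dissociated S
    bounded     : ∀ ε → ∣ lin S ε ∣ ≤ M
    spans       : ∀ z → ∣ z ∣ ≤ M → InSpan S z

open BalancedBasis

balanced-[] : BalancedBasis 0 []
balanced-[] = record { dissociated = λ _ _ () ; bounded = λ _ → z≤n ; spans = spans-[] }
  where
  spans-[] : ∀ z → ∣ z ∣ ≤ 0 → InSpan [] z
  spans-[] (+ zero) _ = span-0 []

span-bounded : BalancedBasis M S → InSpan S z → ∣ z ∣ ≤ M
span-bounded {M} basis (ε , ε↦z) = subst (λ z → ∣ z ∣ ≤ M) ε↦z (bounded basis ε)

balanced-∷ : M < x → x ≤ suc (M + M) → BalancedBasis M S → BalancedBasis (x + M) (x ∷ S)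
balanced-∷ {M} {x} {S} M<x x≤2M+1 basis = record
  { dissociated = dissociated-∷ S (dissociated basis) x∉⟨S⟩
  ; bounded     = bounded-∷
  ; spans       = spans-∷
  }
  where
  x∉⟨S⟩ : ¬ InSpan S (+ x)
  x∉⟨S⟩ = ℕ.<⇒≱ M<x ∘ span-bounded basis

  bounded-∷ : ∀ ε → ∣ lin (x ∷ S) ε ∣ ≤ x + M
  bounded-∷ ε = ℕ.≤-trans (ℤ.∣i+j∣≤∣i∣+∣j∣ (ε 0F · x) (lin S (tail ε)))
                          (ℕ.+-mono-≤ (∣c·x∣≤x (ε 0F) x) (bounded basis (tail ε)))

  -- Above M, subtract x: the result lies in [-M, M] because x ≤ 2M + 1.
  spans-ℕ : ∀ n → n ≤ x + M → InSpan (x ∷ S) (+ n)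
  spans-ℕ n n≤x+M with n ≤? M
  ... | yes n≤M =
    span-∷⁺ S zer (subst (InSpan S) (sym (ℤ.+-identityʳ (+ n))) (spans basis (+ n) n≤M))
  ... | no  n≰M =
    span-∷⁺ S pos (subst (InSpan S) (sym n-x≡n⊖x) (spans basis (n ℤ.⊖ x) (∣m⊖n∣≤ n≤x+M x≤n+M)))
    where
    x≤n+M : x ≤ n + M
    x≤n+M = ℕ.≤-trans x≤2M+1 (ℕ.+-monoˡ-≤ M (ℕ.≰⇒> n≰M))
    n-x≡n⊖x : + n ℤ.- pos · x ≡ n ℤ.⊖ x
    n-x≡n⊖x = trans (cong (λ t → + n ℤ.- t) (pos·x≡x x)) (ℤ.m-n≡m⊖n n x)

  spans-∷ : ∀ z → ∣ z ∣ ≤ x + M → InSpan (x ∷ S) z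
  spans-∷ (+ n)                = spans-ℕ n
  spans-∷ -[1+ n ] ∣z∣≤x+M = span-neg (x ∷ S) (spans-ℕ (suc n) ∣z∣≤x+M)

ternary-basis : ∀ e → ∃₂ λ M P → 3 ^ e ≡ suc (M + M) × length P ≡ e × BalancedBasis M P
ternary-basis zero = 0 , [] , refl , refl , balanced-[]
ternary-basis (suc e) with ternary-basis e
... | M , P , 3^e≡2M+1 , |P|≡e , basis =
  3 ^ e + M , 3 ^ e ∷ P , 3^[1+e]≡ , cong suc |P|≡e ,
  balanced-∷ (subst (M <_) (sym 3^e≡2M+1) (s≤s (ℕ.m≤m+n M M))) (ℕ.≤-reflexive 3^e≡2M+1) basis
  where
  3[2M+1]≡2[2M+1+M]+1 : ∀ M → 3 * suc (M + M) ≡ suc ((suc (M + M) + M) + (suc (M + M) + M))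
  3[2M+1]≡2[2M+1+M]+1 = ℕ-Solver.solve-∀

  3^[1+e]≡ : 3 ^ suc e ≡ suc ((3 ^ e + M) + (3 ^ e + M))
  3^[1+e]≡ = begin
    3 * 3 ^ e                                   ≡⟨ cong (3 *_) 3^e≡2M+1 ⟩
    3 * suc (M + M)                             ≡⟨ 3[2M+1]≡2[2M+1+M]+1 M ⟩
    suc ((suc (M + M) + M) + (suc (M + M) + M))
      ≡⟨ cong (λ t → suc ((t + M) + (t + M))) 3^e≡2M+1 ⟨
    suc ((3 ^ e + M) + (3 ^ e + M))             ∎
    where open ≡-Reasoning

spanning-length : ∀ {e} → 3 ^ e < 2 * N → ∀ S → SpansInterval N S → suc e ≤ length S
spanning-length {N} {e} 3^e<2N S span = ℕ.≰⇒> λ |S|≤e → ℕ.<-irrefl refl (begin-strict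
  3 ^ length S  ≤⟨ ℕ.^-monoʳ-≤ 3 |S|≤e ⟩
  3 ^ e         <⟨ 3^e<2N ⟩
  2 * N         ≡⟨ 2*n≡n+n N ⟩
  N + N         <⟨ spansInterval-size S span ⟩
  3 ^ length S  ∎)
  where open ℕ.≤-Reasoning

-- The witness is {1, 3, …, 3^(e-1), N ⊓ 3^e}.
interval-basis : ∀ {e} → 3 ^ e < 2 * N → 2 * N ≤ 3 ^ suc e →
  ∃ λ S → SubsetOfInterval N S × Dissociated S × SpansInterval N S × length S ≡ suc e
interval-basis {N} {e} 3^e<2N 2N≤3^[1+e] with ternary-basis e
... | M , P , 3^e≡2M+1 , |P|≡e , basis =
  top ∷ P , dissociated⇒subsetOfInterval (top ∷ P) (dissociated basis′) ≤N ,
  dissociated basis′ , spans[N] , cong suc |P|≡e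
  where
  top : ℕ
  top = N ⊓ 3 ^ e

  M<N : M < N
  M<N = ℕ.*-cancelˡ-≤ 2 (begin
    2 * suc M          ≡⟨ 2[1+M]≡2M+2 M ⟩
    suc (suc (M + M))  ≡⟨ cong suc 3^e≡2M+1 ⟨
    suc (3 ^ e)        ≤⟨ 3^e<2N ⟩
    2 * N              ∎)
    where
    open ℕ.≤-Reasoning
    2[1+M]≡2M+2 : ∀ M → 2 * suc M ≡ suc (suc (M + M))
    2[1+M]≡2M+2 = ℕ-Solver.solve-∀

  N≤3^e+M : N ≤ 3 ^ e + M
  N≤3^e+M = s≤s⁻¹ (ℕ.*-cancelˡ-< 2 N (suc (3 ^ e + M)) (begin-strict
    2 * N                       ≤⟨ 2N≤3^[1+e] ⟩
    3 * 3 ^ e                   ≡⟨ cong (3 *_) 3^e≡2M+1 ⟩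
    3 * suc (M + M)             <⟨ ℕ.n<1+n _ ⟩
    suc (3 * suc (M + M))       ≡⟨ 1+3[2M+1]≡2[2M+2+M] M ⟩
    2 * suc (suc (M + M) + M)   ≡⟨ cong (λ t → 2 * suc (t + M)) 3^e≡2M+1 ⟨
    2 * suc (3 ^ e + M)         ∎))
    where
    open ℕ.≤-Reasoning
    1+3[2M+1]≡2[2M+2+M] : ∀ M → suc (3 * suc (M + M)) ≡ 2 * suc (suc (M + M) + M)
    1+3[2M+1]≡2[2M+2+M] = ℕ-Solver.solve-∀

  M<top : M < top
  M<top = ℕ.⊓-glb M<N (subst (M <_) (sym 3^e≡2M+1) (s≤s (ℕ.m≤m+n M M)))

  basis′ : BalancedBasis (top + M) (top ∷ P)
  basis′ = balanced-∷ M<top (ℕ.≤-trans (ℕ.m⊓n≤n N (3 ^ e)) (ℕ.≤-reflexive 3^e≡2M+1)) basis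

  N≤top+M : N ≤ top + M
  N≤top+M = subst (N ≤_) (sym (ℕ.+-distribʳ-⊓ M N (3 ^ e))) (ℕ.⊓-glb (ℕ.m≤m+n N M) N≤3^e+M)

  spans[N] : SpansInterval N (top ∷ P)
  spans[N] y (_ , y≤N) = spans basis′ (+ y) (ℕ.≤-trans y≤N N≤top+M)

  ≤N : ∀ {y} → y ∈ top ∷ P → y ≤ N
  ≤N (here refl)  = ℕ.m⊓n≤m N (3 ^ e)
  ≤N (there y∈P) = ℕ.≤-trans (span-bounded basis (∈⇒span y∈P)) (ℕ.<⇒≤ M<N)

interval-dimension : ∀ N e → 3 ^ e < 2 * N → 2 * N ≤ 3 ^ suc e →
                     IsDs N (suc e) × IsDdMinus N (suc e)
interval-dimension N e 3^e<2N 2N≤3^[1+e] with interval-basis 3^e<2N 2N≤3^[1+e]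
... | S , S⊆[N] , diss , span , |S|≡1+e =
  ((S , S⊆[N] , span , |S|≡1+e) ,
   λ { _ (T , _ , T-span , refl) → spanning-length 3^e<2N T T-span }) ,
  ((S , spanning⇒maxDissociated S S⊆[N] diss span , |S|≡1+e) ,
   λ { _ (D , D-max , refl) → spanning-length 3^e<2N D (maxDissociated⇒spans D D-max) })

theorem1p6 : (N : ℕ) → 1 ≤ N → (k m : ℕ) → IsFloorLog3 N k → IsCeilLog3Sub N k m →
    IsDs N (k + m) × IsDdMinus N (k + m)
theorem1p6 N 1≤N k zero (3^k≤N , _) (2N≤3^[k+0] , _) = contradiction N<N (ℕ.<-irrefl refl)
  where
  open ℕ.≤-Reasoning
  N<N : N < N
  N<N = begin-strict
    N           <⟨ ℕ.m<m+n N (ℕ.≤-trans 1≤N (ℕ.m≤m+n N 0)) ⟩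
    2 * N       ≤⟨ 2N≤3^[k+0] ⟩
    3 ^ (k + 0) ≡⟨ cong (3 ^_) (ℕ.+-identityʳ k) ⟩
    3 ^ k       ≤⟨ 3^k≤N ⟩
    N           ∎
theorem1p6 N _ k (suc m) _ (2N≤3^[k+1+m] , minimal) =
  subst (λ n → IsDs N n × IsDdMinus N n) (sym (ℕ.+-suc k m))
    (interval-dimension N (k + m) (minimal m (ℕ.n<1+n m))
      (subst (λ n → 2 * N ≤ 3 ^ n) (ℕ.+-suc k m) 2N≤3^[k+1+m]))
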